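{- Let $N\ge2$. The solutions of $(E_N)$ of size 4 are exactly the 4-tuples $(-a,b,a,-b)$ with $a,b\in\mathbb{Z}/N\mathbb{Z}$ and $ab=0$, and the 4-tuples $(a,b,a,b)$ with $a,b\in\mathbb{Z}/N\mathbb{Z}$ and $ab=2$.
   Context: For $a_1,\dots,a_n\in\mathbb{Z}/N\mathbb{Z}$ set $M_n(a_1,\dots,a_n)=\begin{pmatrix}a_n&-1\\1&0\end{pmatrix}\cdots\begin{pmatrix}a_1&-1\\1&0\end{pmatrix}$. An $n$-tuple $(a_1,\dots,a_n)\in(\mathbb{Z}/N\mathbb{Z})^n$ is a solution of $(E_N)$ of size $n$ if $M_n(a_1,\dots,a_n)=\pm\mathrm{Id}$ over $\mathbb{Z}/N\mathbb{Z}$. -}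

module Defs where

open import Data.Nat using (ℕ)
open import Data.Integer using (ℤ; +_; _+_; _-_; _*_; -_)
open import Data.Integer.Divisibility using (_∣_)
open import Data.Product using (_×_; ∃₂)
open import Data.Sum using (_⊎_)

-- ℤ/Nℤ is represented by integer representatives; equality in ℤ/Nℤ is
-- congruence modulo N.
_≡_[mod_] : ℤ → ℤ → ℕ → Set
a ≡ b [mod N ] = (+ N) ∣ (a - b)

infix 4 _≡_[mod_]

record Mat : Set where
  constructor mat
  field
    m11 m12 m21 m22 : ℤ

_⊗_ : Mat → Mat → Mat
mat a b c d ⊗ mat e f g h =
  mat (a * e + b * g) (a * f + b * h) (c * e + d * g) (c * f + d * h)

infixl 7 _⊗_

Mx : ℤ → Mat
Mx a = mat a (- + 1) (+ 1) (+ 0)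

M4 : ℤ → ℤ → ℤ → ℤ → Mat
M4 a₁ a₂ a₃ a₄ = Mx a₄ ⊗ Mx a₃ ⊗ Mx a₂ ⊗ Mx a₁

_≋_[mod_] : Mat → Mat → ℕ → Set
mat a b c d ≋ mat e f g h [mod N ] =
  (a ≡ e [mod N ]) × (b ≡ f [mod N ]) × (c ≡ g [mod N ]) × (d ≡ h [mod N ])

Id : Mat
Id = mat (+ 1) (+ 0) (+ 0) (+ 1)

-Id : Mat
-Id = mat (- + 1) (+ 0) (+ 0) (- + 1)

IsSolution4 : ℕ → ℤ → ℤ → ℤ → ℤ → Set
IsSolution4 N a₁ a₂ a₃ a₄ = (M4 a₁ a₂ a₃ a₄ ≋ Id [mod N ]) ⊎ (M4 a₁ a₂ a₃ a₄ ≋ -Id [mod N ])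

module Submission where

-- Multiplying out, M₄(a₁,a₂,a₃,a₄) has entries m₂₂ = 1 - a₂a₃, m₂₁ = a₁a₂a₃ - a₁ - a₃ and
-- m₁₂ = a₂ + a₄ - a₂a₃a₄.  If M₄ ≡ ε·Id then m₂₂ gives a₂a₃ ≡ 1 - ε, and substituting this
-- into m₂₁ ≡ m₁₂ ≡ 0 leaves a₁ ≡ -ε a₃ and a₄ ≡ -ε a₂: with a = a₃ and b = a₂ this is
-- (-a,b,a,-b) with ab ≡ 0 for ε = 1 and (a,b,a,b) with ab ≡ 2 for ε = -1.  Conversely, on
-- these tuples every entry of M₄ is a polynomial in ab, which evaluates to the entry of ±Id.

open import Defs
open import Data.Nat using (ℕ; _≤_)
open import Data.Integer using (ℤ; +_; _+_; _-_; _*_; -_)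
open import Data.Integer.Properties using (+-inverseʳ)
open import Data.Integer.Divisibility.Signed
  using (_∣_; divides; ∣ᵤ⇒∣; ∣⇒∣ᵤ; ∣m∣n⇒∣m+n; ∣m⇒∣-m; ∣n⇒∣m*n)
open import Data.Integer.Tactic.RingSolver using (solve)
open import Data.List using (List; []; _∷_)
open import Data.Product using (_×_; _,_; ∃₂; proj₁; proj₂)
open import Data.Sum using (_⊎_)
open import Data.Sum.Function.Propositional using (_⊎-⇔_)
open import Function.Bundles using (_⇔_; mk⇔)
open import Level using (0ℓ)
open import Relation.Binary.Bundles using (Setoid)
open import Relation.Binary.PropositionalEquality
  using (_≡_; refl; sym; trans; cong; subst; module ≡-Reasoning)
import Relation.Binary.Reasoning.Setoid as SetoidReasoning

mat-cong : ∀ {p q r s p′ q′ r′ s′} → p ≡ p′ → q ≡ q′ → r ≡ r′ → s ≡ s′ →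
           mat p q r s ≡ mat p′ q′ r′ s′
mat-cong refl refl refl refl = refl

⊗-Mx : ∀ p q r s a → mat p q r s ⊗ Mx a ≡ mat (p * a + q) (- p) (r * a + s) (- r)
⊗-Mx p q r s a =
  mat-cong (first-column p q) (second-column p q) (first-column r s) (second-column r s)
  where
  first-column : ∀ x y → x * a + y * + 1 ≡ x * a + y
  first-column x y = solve (x ∷ y ∷ a ∷ [])
  second-column : ∀ x y → x * - + 1 + y * + 0 ≡ - x
  second-column x y = solve (x ∷ y ∷ [])

Mx⊗Mx : ∀ a b → Mx a ⊗ Mx b ≡ mat (a * b - + 1) (- a) b (- + 1)
Mx⊗Mx a b = trans (⊗-Mx a (- + 1) (+ 1) (+ 0) b) (mat-cong refl refl (solve (b ∷ [])) refl)

M4-expanded : ℤ → ℤ → ℤ → ℤ → Mat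
M4-expanded a₁ a₂ a₃ a₄ =
  mat (a₁ * a₂ * a₃ * a₄ - a₁ * a₂ - a₃ * a₄ - a₁ * a₄ + + 1) (a₂ + a₄ - a₂ * a₃ * a₄)
      (a₁ * a₂ * a₃ - a₁ - a₃) (+ 1 - a₂ * a₃)

M4≡M4-expanded : ∀ a₁ a₂ a₃ a₄ → M4 a₁ a₂ a₃ a₄ ≡ M4-expanded a₁ a₂ a₃ a₄
M4≡M4-expanded a₁ a₂ a₃ a₄ = begin
  M4 a₁ a₂ a₃ a₄
    ≡⟨ cong (λ M → M ⊗ Mx a₂ ⊗ Mx a₁) (Mx⊗Mx a₄ a₃) ⟩
  mat (a₄ * a₃ - + 1) (- a₄) a₃ (- + 1) ⊗ Mx a₂ ⊗ Mx a₁
    ≡⟨ cong (_⊗ Mx a₁) (⊗-Mx (a₄ * a₃ - + 1) (- a₄) a₃ (- + 1) a₂) ⟩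
  mat ((a₄ * a₃ - + 1) * a₂ - a₄) (- (a₄ * a₃ - + 1)) (a₃ * a₂ - + 1) (- a₃) ⊗ Mx a₁
    ≡⟨ ⊗-Mx ((a₄ * a₃ - + 1) * a₂ - a₄) (- (a₄ * a₃ - + 1)) (a₃ * a₂ - + 1) (- a₃) a₁ ⟩
  mat (((a₄ * a₃ - + 1) * a₂ - a₄) * a₁ - (a₄ * a₃ - + 1)) (- ((a₄ * a₃ - + 1) * a₂ - a₄))
      ((a₃ * a₂ - + 1) * a₁ - a₃) (- (a₃ * a₂ - + 1))
    ≡⟨ mat-cong (solve vars) (solve vars) (solve vars) (solve vars) ⟩
  M4-expanded a₁ a₂ a₃ a₄ ∎
  where
  open ≡-Reasoning
  vars : List ℤ
  vars = a₁ ∷ a₂ ∷ a₃ ∷ a₄ ∷ []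

AntiperiodicSolution : ℕ → ℤ → ℤ → ℤ → ℤ → Set
AntiperiodicSolution N a₁ a₂ a₃ a₄ =
  ∃₂ λ a b → (a * b ≡ + 0 [mod N ]) × (a₁ ≡ - a [mod N ]) × (a₂ ≡ b [mod N ])
             × (a₃ ≡ a [mod N ]) × (a₄ ≡ - b [mod N ])

PeriodicSolution : ℕ → ℤ → ℤ → ℤ → ℤ → Set
PeriodicSolution N a₁ a₂ a₃ a₄ =
  ∃₂ λ a b → (a * b ≡ + 2 [mod N ]) × (a₁ ≡ a [mod N ]) × (a₂ ≡ b [mod N ])
             × (a₃ ≡ a [mod N ]) × (a₄ ≡ b [mod N ])

module Modulo (N : ℕ) where

  infix 4 _≈_ _≈ₘ_

  -- Unlike x ≡ y [mod N ], which only exposes ∣ x - y ∣, this record type determines x and y,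
  -- so Agda can infer them as implicit arguments.
  record _≈_ (x y : ℤ) : Set where
    constructor mk≈
    field N∣x-y : + N ∣ x - y
  open _≈_

  ≡mod⇒≈ : ∀ {x y} → x ≡ y [mod N ] → x ≈ y
  ≡mod⇒≈ p = mk≈ (∣ᵤ⇒∣ p)

  ≈⇒≡mod : ∀ {x y} → x ≈ y → x ≡ y [mod N ]
  ≈⇒≡mod p = ∣⇒∣ᵤ (N∣x-y p)

  ∣⇒≈ : ∀ {e x y} → + N ∣ e → e ≡ x - y → x ≈ y
  ∣⇒≈ N∣e refl = mk≈ N∣e

  ≈-refl : ∀ {x} → x ≈ x
  ≈-refl {x} = ∣⇒≈ (divides (+ 0) refl) (sym (+-inverseʳ x))

  ≈-sym : ∀ {x y} → x ≈ y → y ≈ x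
  ≈-sym {x} {y} (mk≈ p) = ∣⇒≈ (∣m⇒∣-m p) (solve (x ∷ y ∷ []))

  ≈-trans : ∀ {x y z} → x ≈ y → y ≈ z → x ≈ z
  ≈-trans {x} {y} {z} (mk≈ p) (mk≈ q) = ∣⇒≈ (∣m∣n⇒∣m+n p q) (solve (x ∷ y ∷ z ∷ []))

  +-cong : ∀ {x y u v} → x ≈ y → u ≈ v → x + u ≈ y + v
  +-cong {x} {y} {u} {v} (mk≈ p) (mk≈ q) =
    ∣⇒≈ (∣m∣n⇒∣m+n p q) (solve (x ∷ y ∷ u ∷ v ∷ []))

  -‿cong : ∀ {x y} → x ≈ y → - x ≈ - y
  -‿cong {x} {y} (mk≈ p) = ∣⇒≈ (∣m⇒∣-m p) (solve (x ∷ y ∷ []))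

  *-cong : ∀ {x y u v} → x ≈ y → u ≈ v → x * u ≈ y * v
  *-cong {x} {y} {u} {v} (mk≈ p) (mk≈ q) =
    ∣⇒≈ (∣m∣n⇒∣m+n (∣n⇒∣m*n u p) (∣n⇒∣m*n y q)) (solve (x ∷ y ∷ u ∷ v ∷ []))

  ≈-setoid : Setoid 0ℓ 0ℓ
  ≈-setoid = record
    { Carrier       = ℤ
    ; _≈_           = _≈_
    ; isEquivalence = record { refl = ≈-refl ; sym = ≈-sym ; trans = ≈-trans }
    }

  _≈ₘ_ : Mat → Mat → Set
  mat a b c d ≈ₘ mat e f g h = (a ≈ e) × (b ≈ f) × (c ≈ g) × (d ≈ h)

  ≋⇒≈ₘ : ∀ {A B} → A ≋ B [mod N ] → A ≈ₘ B
  ≋⇒≈ₘ (p , q , r , s) = ≡mod⇒≈ p , ≡mod⇒≈ q , ≡mod⇒≈ r , ≡mod⇒≈ s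

  ≈ₘ⇒≋ : ∀ {A B} → A ≈ₘ B → A ≋ B [mod N ]
  ≈ₘ⇒≋ (p , q , r , s) = ≈⇒≡mod p , ≈⇒≡mod q , ≈⇒≡mod r , ≈⇒≡mod s

  ≈ₘ-trans : ∀ {A B C} → A ≈ₘ B → B ≈ₘ C → A ≈ₘ C
  ≈ₘ-trans (p , q , r , s) (p′ , q′ , r′ , s′) =
    ≈-trans p p′ , ≈-trans q q′ , ≈-trans r r′ , ≈-trans s s′

  ⊗-cong : ∀ {A A′ B B′} → A ≈ₘ A′ → B ≈ₘ B′ → A ⊗ B ≈ₘ A′ ⊗ B′
  ⊗-cong (a , b , c , d) (e , f , g , h) =
    +-cong (*-cong a e) (*-cong b g) , +-cong (*-cong a f) (*-cong b h) ,
    +-cong (*-cong c e) (*-cong d g) , +-cong (*-cong c f) (*-cong d h)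

  M4-cong : ∀ a₁ a₂ a₃ a₄ b₁ b₂ b₃ b₄ → a₁ ≈ b₁ → a₂ ≈ b₂ → a₃ ≈ b₃ → a₄ ≈ b₄ →
            M4 a₁ a₂ a₃ a₄ ≈ₘ M4 b₁ b₂ b₃ b₄
  M4-cong _ _ _ _ _ _ _ _ e₁ e₂ e₃ e₄ =
    ⊗-cong (⊗-cong (⊗-cong (Mx-cong e₄) (Mx-cong e₃)) (Mx-cong e₂)) (Mx-cong e₁)
    where
    Mx-cong : ∀ {a b} → a ≈ b → Mx a ≈ₘ Mx b
    Mx-cong e = e , ≈-refl , ≈-refl , ≈-refl

  open SetoidReasoning ≈-setoid

  M4≈Id⇒antiperiodic : ∀ a₁ a₂ a₃ a₄ →
                       M4 a₁ a₂ a₃ a₄ ≈ₘ Id → AntiperiodicSolution N a₁ a₂ a₃ a₄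
  M4≈Id⇒antiperiodic a₁ a₂ a₃ a₄ M≈Id =
    a₃ , a₂ , ≈⇒≡mod a₃a₂≈0 , ≈⇒≡mod a₁≈-a₃ , ≈⇒≡mod (≈-refl {a₂}) , ≈⇒≡mod (≈-refl {a₃}) ,
    ≈⇒≡mod a₄≈-a₂
    where
    entries : M4-expanded a₁ a₂ a₃ a₄ ≈ₘ Id
    entries = subst (_≈ₘ Id) (M4≡M4-expanded a₁ a₂ a₃ a₄) M≈Id

    m₁₂≈0 : a₂ + a₄ - a₂ * a₃ * a₄ ≈ + 0
    m₁₂≈0 = proj₁ (proj₂ entries)

    m₂₁≈0 : a₁ * a₂ * a₃ - a₁ - a₃ ≈ + 0
    m₂₁≈0 = proj₁ (proj₂ (proj₂ entries))

    m₂₂≈1 : + 1 - a₂ * a₃ ≈ + 1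
    m₂₂≈1 = proj₂ (proj₂ (proj₂ entries))

    a₃a₂≈0 : a₃ * a₂ ≈ + 0
    a₃a₂≈0 = begin
      a₃ * a₂                ≡⟨ solve (a₂ ∷ a₃ ∷ []) ⟩
      + 1 - (+ 1 - a₂ * a₃)  ≈⟨ +-cong (≈-refl {+ 1}) (-‿cong m₂₂≈1) ⟩
      + 1 - + 1              ∎

    a₁≈-a₃ : a₁ ≈ - a₃
    a₁≈-a₃ = begin
      a₁
        ≡⟨ solve (a₁ ∷ a₂ ∷ a₃ ∷ []) ⟩
      a₁ * (a₃ * a₂) - (a₁ * a₂ * a₃ - a₁ - a₃) - a₃
        ≈⟨ +-cong (+-cong (*-cong (≈-refl {a₁}) a₃a₂≈0) (-‿cong m₂₁≈0)) ≈-refl ⟩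
      a₁ * + 0 - + 0 - a₃
        ≡⟨ solve (a₁ ∷ a₃ ∷ []) ⟩
      - a₃ ∎

    a₄≈-a₂ : a₄ ≈ - a₂
    a₄≈-a₂ = begin
      a₄
        ≡⟨ solve (a₂ ∷ a₃ ∷ a₄ ∷ []) ⟩
      (a₂ + a₄ - a₂ * a₃ * a₄) + a₄ * (a₃ * a₂) - a₂
        ≈⟨ +-cong (+-cong m₁₂≈0 (*-cong (≈-refl {a₄}) a₃a₂≈0)) ≈-refl ⟩
      + 0 + a₄ * + 0 - a₂
        ≡⟨ solve (a₂ ∷ a₄ ∷ []) ⟩
      - a₂ ∎

  M4≈-Id⇒periodic : ∀ a₁ a₂ a₃ a₄ →
                    M4 a₁ a₂ a₃ a₄ ≈ₘ -Id → PeriodicSolution N a₁ a₂ a₃ a₄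
  M4≈-Id⇒periodic a₁ a₂ a₃ a₄ M≈-Id =
    a₃ , a₂ , ≈⇒≡mod a₃a₂≈2 , ≈⇒≡mod a₁≈a₃ , ≈⇒≡mod (≈-refl {a₂}) , ≈⇒≡mod (≈-refl {a₃}) ,
    ≈⇒≡mod a₄≈a₂
    where
    entries : M4-expanded a₁ a₂ a₃ a₄ ≈ₘ -Id
    entries = subst (_≈ₘ -Id) (M4≡M4-expanded a₁ a₂ a₃ a₄) M≈-Id

    m₁₂≈0 : a₂ + a₄ - a₂ * a₃ * a₄ ≈ + 0
    m₁₂≈0 = proj₁ (proj₂ entries)

    m₂₁≈0 : a₁ * a₂ * a₃ - a₁ - a₃ ≈ + 0
    m₂₁≈0 = proj₁ (proj₂ (proj₂ entries))

    m₂₂≈-1 : + 1 - a₂ * a₃ ≈ - + 1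
    m₂₂≈-1 = proj₂ (proj₂ (proj₂ entries))

    a₃a₂≈2 : a₃ * a₂ ≈ + 2
    a₃a₂≈2 = begin
      a₃ * a₂                ≡⟨ solve (a₂ ∷ a₃ ∷ []) ⟩
      + 1 - (+ 1 - a₂ * a₃)  ≈⟨ +-cong (≈-refl {+ 1}) (-‿cong m₂₂≈-1) ⟩
      + 1 - - + 1            ∎

    a₃a₂-2≈0 : a₃ * a₂ - + 2 ≈ + 0
    a₃a₂-2≈0 = +-cong a₃a₂≈2 (≈-refl { - + 2})

    a₁≈a₃ : a₁ ≈ a₃
    a₁≈a₃ = begin
      a₁
        ≡⟨ solve (a₁ ∷ a₂ ∷ a₃ ∷ []) ⟩
      a₃ + (a₁ * a₂ * a₃ - a₁ - a₃) - a₁ * (a₃ * a₂ - + 2)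
        ≈⟨ +-cong (+-cong (≈-refl {a₃}) m₂₁≈0) (-‿cong (*-cong (≈-refl {a₁}) a₃a₂-2≈0)) ⟩
      a₃ + + 0 - a₁ * + 0
        ≡⟨ solve (a₁ ∷ a₃ ∷ []) ⟩
      a₃ ∎

    a₄≈a₂ : a₄ ≈ a₂
    a₄≈a₂ = begin
      a₄
        ≡⟨ solve (a₂ ∷ a₃ ∷ a₄ ∷ []) ⟩
      a₂ - (a₂ + a₄ - a₂ * a₃ * a₄) - a₄ * (a₃ * a₂ - + 2)
        ≈⟨ +-cong (+-cong (≈-refl {a₂}) (-‿cong m₁₂≈0)) (-‿cong (*-cong (≈-refl {a₄}) a₃a₂-2≈0)) ⟩
      a₂ - + 0 - a₄ * + 0
        ≡⟨ solve (a₂ ∷ a₄ ∷ []) ⟩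
      a₂ ∎

  M4[-a,b,a,-b]≈Id : ∀ a b → a * b ≈ + 0 → M4 (- a) b a (- b) ≈ₘ Id
  M4[-a,b,a,-b]≈Id a b ab≈0 = subst (_≈ₘ Id) (sym M4[-a,b,a,-b]) entries
    where
    vars : List ℤ
    vars = a ∷ b ∷ []

    M4[-a,b,a,-b] : M4 (- a) b a (- b) ≡
      mat (a * b * (a * b) + a * b + + 1) (a * b * b) (- (a * b * a)) (+ 1 - a * b)
    M4[-a,b,a,-b] = trans (M4≡M4-expanded (- a) b a (- b))
      (mat-cong (solve vars) (solve vars) (solve vars) (solve vars))


    entries : mat (a * b * (a * b) + a * b + + 1) (a * b * b)
                  (- (a * b * a)) (+ 1 - a * b) ≈ₘ Id
    entries =
      +-cong (+-cong (*-cong ab≈0 ab≈0) ab≈0) (≈-refl {+ 1}) ,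
      *-cong ab≈0 (≈-refl {b}) ,
      -‿cong (*-cong ab≈0 (≈-refl {a})) ,
      +-cong (≈-refl {+ 1}) (-‿cong ab≈0)

  M4[a,b,a,b]≈-Id : ∀ a b → a * b ≈ + 2 → M4 a b a b ≈ₘ -Id
  M4[a,b,a,b]≈-Id a b ab≈2 = subst (_≈ₘ -Id) (sym M4[a,b,a,b]) entries
    where
    vars : List ℤ
    vars = a ∷ b ∷ []

    M4[a,b,a,b] : M4 a b a b ≡
      mat (a * b * (a * b) - + 3 * (a * b) + + 1) ((+ 2 - a * b) * b)
          ((a * b - + 2) * a) (+ 1 - a * b)
    M4[a,b,a,b] = trans (M4≡M4-expanded a b a b)
      (mat-cong (solve vars) (solve vars) (solve vars) (solve vars))


    entries : mat (a * b * (a * b) - + 3 * (a * b) + + 1) ((+ 2 - a * b) * b)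
                  ((a * b - + 2) * a) (+ 1 - a * b) ≈ₘ -Id
    entries =
      +-cong (+-cong (*-cong ab≈2 ab≈2) (-‿cong (*-cong (≈-refl {+ 3}) ab≈2))) (≈-refl {+ 1}) ,
      *-cong (+-cong (≈-refl {+ 2}) (-‿cong ab≈2)) (≈-refl {b}) ,
      *-cong (+-cong ab≈2 (≈-refl { - + 2})) (≈-refl {a}) ,
      +-cong (≈-refl {+ 1}) (-‿cong ab≈2)

  M4≋Id⇔antiperiodic : ∀ a₁ a₂ a₃ a₄ →
                       M4 a₁ a₂ a₃ a₄ ≋ Id [mod N ] ⇔ AntiperiodicSolution N a₁ a₂ a₃ a₄
  M4≋Id⇔antiperiodic a₁ a₂ a₃ a₄ = mk⇔ to from
    where
    to : M4 a₁ a₂ a₃ a₄ ≋ Id [mod N ] → AntiperiodicSolution N a₁ a₂ a₃ a₄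
    to M≋Id = M4≈Id⇒antiperiodic a₁ a₂ a₃ a₄ (≋⇒≈ₘ {M4 a₁ a₂ a₃ a₄} {Id} M≋Id)

    from : AntiperiodicSolution N a₁ a₂ a₃ a₄ → M4 a₁ a₂ a₃ a₄ ≋ Id [mod N ]
    from (a , b , ab≡0 , a₁≡-a , a₂≡b , a₃≡a , a₄≡-b) = ≈ₘ⇒≋ {M4 a₁ a₂ a₃ a₄} {Id}
      (≈ₘ-trans (M4-cong a₁ a₂ a₃ a₄ (- a) b a (- b)
                   (≡mod⇒≈ a₁≡-a) (≡mod⇒≈ a₂≡b) (≡mod⇒≈ a₃≡a) (≡mod⇒≈ a₄≡-b))
                (M4[-a,b,a,-b]≈Id a b (≡mod⇒≈ ab≡0)))

  M4≋-Id⇔periodic : ∀ a₁ a₂ a₃ a₄ →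
                    M4 a₁ a₂ a₃ a₄ ≋ -Id [mod N ] ⇔ PeriodicSolution N a₁ a₂ a₃ a₄
  M4≋-Id⇔periodic a₁ a₂ a₃ a₄ = mk⇔ to from
    where
    to : M4 a₁ a₂ a₃ a₄ ≋ -Id [mod N ] → PeriodicSolution N a₁ a₂ a₃ a₄
    to M≋-Id = M4≈-Id⇒periodic a₁ a₂ a₃ a₄ (≋⇒≈ₘ {M4 a₁ a₂ a₃ a₄} { -Id} M≋-Id)

    from : PeriodicSolution N a₁ a₂ a₃ a₄ → M4 a₁ a₂ a₃ a₄ ≋ -Id [mod N ]
    from (a , b , ab≡2 , a₁≡a , a₂≡b , a₃≡a , a₄≡b) = ≈ₘ⇒≋ {M4 a₁ a₂ a₃ a₄} { -Id}
      (≈ₘ-trans (M4-cong a₁ a₂ a₃ a₄ a b a b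
                   (≡mod⇒≈ a₁≡a) (≡mod⇒≈ a₂≡b) (≡mod⇒≈ a₃≡a) (≡mod⇒≈ a₄≡b))
                (M4[a,b,a,b]≈-Id a b (≡mod⇒≈ ab≡2)))

proposition3p3 : (N : ℕ) → 2 ≤ N → (a₁ a₂ a₃ a₄ : ℤ) →
    IsSolution4 N a₁ a₂ a₃ a₄ ⇔
      ((∃₂ λ a b → (a * b ≡ + 0 [mod N ]) × (a₁ ≡ - a [mod N ]) × (a₂ ≡ b [mod N ])
                   × (a₃ ≡ a [mod N ]) × (a₄ ≡ - b [mod N ]))
      ⊎ (∃₂ λ a b → (a * b ≡ + 2 [mod N ]) × (a₁ ≡ a [mod N ]) × (a₂ ≡ b [mod N ])
                   × (a₃ ≡ a [mod N ]) × (a₄ ≡ b [mod N ])))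
proposition3p3 N _ a₁ a₂ a₃ a₄ =
  M4≋Id⇔antiperiodic a₁ a₂ a₃ a₄ ⊎-⇔ M4≋-Id⇔periodic a₁ a₂ a₃ a₄
  where open Modulo N
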